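{- For every command $C$ and all $P,Q\subseteq\Sigma$, interpreted in the Boolean semiring: $\vDash\langle P\rangle\,C\,\langle\boxdot Q\rangle$ holds iff $P\subseteq[C]^\star Q$, iff the total-correctness Hoare triple $[P]\,C\,[Q]$ is valid.
   Context: Work in the Boolean semiring $\langle\{0,1\},\lor,\land,0,1\rangle$ (top element $\top=1$). Let $\Sigma$ be a set of program states and $\natural\notin\Sigma$ a distinguished element representing nontermination, $\Sigma_\natural=\Sigma\cup\{\natural\}$. Weighting functions $m:\Sigma_\natural\to\{0,1\}$ are identified with subsets of $\Sigma_\natural$ (their supports); the mass $|m|$ is $1$ iff the support is nonempty. The command $C$ has denotation $\llbracket C\rrbracket:\Sigma\to\mathcal P(\Sigma_\natural)$ (the set of possible outcomes, $\natural$ meaning possible divergence), lifted by $\llbracket C\rrbracket^\dagger(S)=\bigcup_{\sigma\in S\cap\Sigma}\llbracket C\rrbracket(\sigma)\cup(S\cap\{\natural\})$. As a precondition, $P\subseteq\Sigma$ denotes $P^{(1)}=\{m\mid|m|=1,\ \mathrm{supp}(m)\subseteq P\}$. The termination-sensitive box is $\boxdot Q=\{m\mid\mathrm{supp}(m)\subseteq Q\}$. $\vDash\langle\varphi\rangle C\langle\psi\rangle$ iff $\llbracket C\rrbracket^\dagger(m)\in\psi$ for every $m\in\varphi$. The weakest precondition is $[C]^\star Q=\{\sigma\in\Sigma\mid\llbracket C\rrbracket(\sigma)\subseteq Q\}$. The total-correctness triple $[P]C[Q]$ is valid iff for every $\sigma\in P$, $C$ cannot diverge from $\sigma$ ($\natural\notin\llbracket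 C\rrbracket(\sigma)$) and all outcomes lie in $Q$. -}

module Defs where

open import Level using (0ℓ)
open import Data.Maybe using (Maybe; just; nothing)
open import Data.Product using (Σ-syntax; ∃; _×_)
open import Data.Sum using (_⊎_)
open import Data.Empty using (⊥)
open import Relation.Nullary using (¬_)
open import Relation.Unary using (Pred; _⊆_)
open import Relation.Binary.PropositionalEquality using (_≡_)

-- Σ♮ = Σ ∪ {♮}, with ♮ represented by nothing
Σ♮ : Set → Set
Σ♮ S = Maybe S

-- Boolean-semiring weighting functions m : Σ♮ → {0,1}, identified with their supports
Weight : Set → Set₁
Weight S = Pred (Σ♮ S) 0ℓ

Denotation : Set → Set₁
Denotation S = S → Pred (Σ♮ S) 0ℓ

Assertion : Set → Set₁
Assertion S = Pred (Weight S) 0ℓ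

embed : {S : Set} → Pred S 0ℓ → Pred (Σ♮ S) 0ℓ
embed P (just σ) = P σ
embed P nothing  = ⊥

lift : {S : Set} → Denotation S → Weight S → Weight S
lift C m τ = (Σ[ σ ∈ _ ] (m (just σ) × C σ τ)) ⊎ (τ ≡ nothing × m nothing)

-- mass |m| = 1 iff support nonempty
mass1 : {S : Set} → Weight S → Set
mass1 m = ∃ λ x → m x

pre : {S : Set} → Pred S 0ℓ → Assertion S
pre P m = mass1 m × (m ⊆ embed P)

-- termination-sensitive box ⊡Q = { m | supp(m) ⊆ Q }
box : {S : Set} → Pred S 0ℓ → Assertion S
box Q m = m ⊆ embed Q

valid : {S : Set} → Assertion S → Denotation S → Assertion S → Set₁
valid φ C ψ = ∀ m → φ m → ψ (lift C m)

-- weakest precondition [C]⋆Q = { σ ∈ Σ | ⟦C⟧(σ) ⊆ Q }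
wp : {S : Set} → Denotation S → Pred S 0ℓ → Pred S 0ℓ
wp C Q σ = C σ ⊆ embed Q

totalValid : {S : Set} → Pred S 0ℓ → Denotation S → Pred S 0ℓ → Set
totalValid P C Q = ∀ σ → P σ → (¬ C σ nothing) × (∀ τ → C σ (just τ) → Q τ)

{-# OPTIONS --safe #-}
module Submission where

-- Lifting sends a set of states to the union of their outcome sets (keeping ♮), so it
-- maps supports inside P to supports inside Q exactly when every state of P has all
-- its outcomes in Q; the converse is tested on the point mass at σ. Since ♮ ∉ Q,
-- "all outcomes in Q" already excludes divergence, so wp is total correctness.

open import Defs
open import Level using (0ℓ)
open import Data.Product using (_×_; _,_; proj₁; proj₂)
open import Data.Sum using (inj₁; inj₂)
open import Data.Maybe using (just; nothing)
open import Relation.Unary using (Pred; _⊆_; ｛_｝)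
open import Function.Bundles using (_⇔_; mk⇔)
open import Relation.Binary.PropositionalEquality using (refl)

module _ {S : Set} where

  point : S → Weight S
  point σ = ｛ just σ ｝

  point∈pre : ∀ {P : Pred S 0ℓ} {σ} → P σ → pre P (point σ)
  point∈pre p = (just _ , refl) , λ { refl → p }

  ⟦⟧⊆lift-point : ∀ (C : Denotation S) σ → C σ ⊆ lift C (point σ)
  ⟦⟧⊆lift-point C σ c = inj₁ (σ , refl , c)

  lift-preserves-box : ∀ {C : Denotation S} {P Q : Pred S 0ℓ} {m : Weight S} →
    P ⊆ wp C Q → box P m → box Q (lift C m)
  lift-preserves-box P⊆wp m⊆P (inj₁ (_ , mσ , c)) = P⊆wp (m⊆P mσ) c
  lift-preserves-box P⊆wp m⊆P (inj₂ (refl , m♮)) with m⊆P m♮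
  ... | ()

  valid-pre-box⇒⊆wp : ∀ {C : Denotation S} {P Q : Pred S 0ℓ} →
    valid (pre P) C (box Q) → P ⊆ wp C Q
  valid-pre-box⇒⊆wp {C} v {σ} p c = v (point σ) (point∈pre p) (⟦⟧⊆lift-point C σ c)

  ⊆wp⇒valid-pre-box : ∀ {C : Denotation S} {P Q : Pred S 0ℓ} →
    P ⊆ wp C Q → valid (pre P) C (box Q)
  ⊆wp⇒valid-pre-box P⊆wp m (_ , m⊆P) = lift-preserves-box {m = m} P⊆wp m⊆P

  ⊆wp⇒totalValid : ∀ {C : Denotation S} {P Q : Pred S 0ℓ} →
    P ⊆ wp C Q → totalValid P C Q
  ⊆wp⇒totalValid P⊆wp σ p = P⊆wp p , λ τ → P⊆wp p

  totalValid⇒⊆wp : ∀ {C : Denotation S} {P Q : Pred S 0ℓ} →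
    totalValid P C Q → P ⊆ wp C Q
  totalValid⇒⊆wp t {σ} p {just τ}  c = proj₂ (t σ p) τ c
  totalValid⇒⊆wp t {σ} p {nothing} c with proj₁ (t σ p) c
  ... | ()

mainTheorem5 : (S : Set) (C : Denotation S) (P Q : Pred S 0ℓ) →
    (valid (pre P) C (box Q) ⇔ (P ⊆ wp C Q)) × ((P ⊆ wp C Q) ⇔ totalValid P C Q)
mainTheorem5 S C P Q =
  mk⇔ valid-pre-box⇒⊆wp ⊆wp⇒valid-pre-box , mk⇔ ⊆wp⇒totalValid totalValid⇒⊆wp
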